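{- Let $d\ge2$, $X=\{0,\dots,d-1\}$, and let $G\le\mathrm{Aut}(X^*)$ be infinite and self-similar. Then the function $v:G\to\mathbb{Z}_{\ge0}\cup\{\infty\}$ is surjective.
   Context: $X^*$ is the rooted tree of finite words, $X^n$ the words of length $n$ ($X^0$ consists of the empty word). Restriction $g|_w$: $g(wu)=g(w)g|_w(u)$; $G$ is self-similar if $g|_w\in G$ for all $g\in G$, $w\in X^*$. Define $v(e)=\infty$ for the identity, and for $g\ne e$, $v(g)=\max\{n\ge0: g\text{ acts trivially on }X^n\}$. -}

module Defs where

open import Data.Nat using (ℕ; suc)
open import Data.Fin using (Fin)
open import Data.List using (List; length; _++_)
open import Data.Product using (Σ; ∃; _×_; _,_)
import Data.Empty
open import Relation.Binary.PropositionalEquality using (_≡_; _≢_)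

Word : ℕ → Set
Word d = List (Fin d)

-- An automorphism of the rooted tree X^* : a bijection of words which
-- preserves length (levels) and the prefix order (hence the tree edges).
record Aut (d : ℕ) : Set where
  field
    fun    : Word d → Word d
    inv    : Word d → Word d
    inv-l  : ∀ w → inv (fun w) ≡ w
    inv-r  : ∀ w → fun (inv w) ≡ w
    len    : ∀ w → length (fun w) ≡ length w
    prefix : ∀ w u → ∃ λ s → fun (w ++ u) ≡ fun w ++ s
open Aut public

-- G ≤ Aut(X^*) given as a subset (predicate), closed under the group
-- operations (up to extensional equality of the action).
record IsSubgroup {d : ℕ} (G : Aut d → Set) : Set where
  field
    has-id  : ∃ λ e → G e × (∀ w → fun e w ≡ w)
    has-mul : ∀ g h → G g → G h → ∃ λ k → G k × (∀ w → fun k w ≡ fun g (fun h w))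
    has-inv : ∀ g → G g → ∃ λ k → G k × (∀ w → fun k w ≡ inv g w)

-- Self-similarity: for g ∈ G and w ∈ X^*, the restriction g|_w, i.e. the
-- map with g(wu) = g(w) g|_w(u), is (the action of) an element of G.
SelfSimilar : {d : ℕ} → (Aut d → Set) → Set
SelfSimilar {d} G =
  ∀ g → G g → ∀ (w : Word d) → ∃ λ h → G h × (∀ u → fun g (w ++ u) ≡ fun g w ++ fun h u)

Infinite : {d : ℕ} → (Aut d → Set) → Set
Infinite {d} G =
  Σ (ℕ → Aut d) λ f → (∀ i → G (f i)) ×
    (∀ i j → i ≢ j → ∃ λ (w : Word d) → fun (f i) w ≢ fun (f j) w)

data ℕ∞ : Set where
  fin : ℕ → ℕ∞
  ∞   : ℕ∞

TrivialOnLevel : {d : ℕ} → Aut d → ℕ → Set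
TrivialOnLevel {d} g n = ∀ (w : Word d) → length w ≡ n → fun g w ≡ w

-- The graph of v :  v(g) = k.
-- v(g) = ∞ iff g = e; for g ≠ e, v(g) = max{ n : g trivial on X^n }.
-- (Since g trivial on X^(n+1) implies trivial on X^n, "n is the maximum"
--  means trivial on X^n and not trivial on X^(n+1); the latter already
--  forces g ≠ e.)
HasV : {d : ℕ} → Aut d → ℕ∞ → Set
HasV {d} g ∞       = ∀ (w : Word d) → fun g w ≡ w
HasV {d} g (fin n) = TrivialOnLevel g n × ¬Triv
  where ¬Triv = TrivialOnLevel g (suc n) → Data.Empty.⊥

module Submission where

-- For a finite n: X^n carries only finitely many
-- permutations, so two distinct elements of the infinite group G act alike
-- there, and their quotient h ∈ G is nontrivial but trivial on X^n. Let
-- n + k be the last level on which h is trivial and w a moved word of length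
-- n + k + 1. Writing w = u y with |u| = k, h fixes u, and the restriction
-- h|_u ∈ G is trivial on X^n but moves y, so v(h|_u) = n.

open import Defs
open import Data.Nat using (ℕ; zero; suc; _+_; _∸_; _⊓_; _≤_; _<_; _≤′_; ≤′-refl; ≤′-step)
open import Data.Nat.Properties using (≤-refl; <⇒≢; ≤⇒≤′; m≤m+n; m≤n⇒m⊓n≡m; m+n∸m≡n; +-suc; +-comm; suc-injective)
open import Data.Fin using (Fin; toℕ)
import Data.Fin as Fin
open import Data.Fin.Properties using (pigeonhole)
open import Data.List using (List; []; _∷_; [_]; _++_; length; map; take; drop; allFin; cartesianProductWith)
open import Data.List.Properties
  using (≡-dec; ∷-injectiveˡ; ∷-injectiveʳ; ++-cancelˡ; length-++; length-map; length-take; length-drop; take++drop≡id)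
open import Data.List.Relation.Unary.All as All using (All; []; _∷_; all?)
open import Data.List.Relation.Unary.All.Properties using (¬All⇒Any¬; map⁺)
open import Data.List.Relation.Unary.Any using (here; there; index)
open import Data.List.Membership.Propositional using (_∈_; find)
open import Data.List.Membership.Propositional.Properties
  using (∈-allFin; ∈-cartesianProductWith⁺; ∈-cartesianProductWith⁻)
open import Data.List.Membership.Setoid.Properties using (index-injective)
open import Data.Product using (∃; ∃₂; _×_; _,_)
open import Function using (_∘_)
open import Relation.Binary.PropositionalEquality
  using (_≡_; _≢_; refl; sym; trans; cong; cong₂; subst; setoid; module ≡-Reasoning)
open import Relation.Nullary using (¬_; Dec; yes; no; contradiction)
open import Relation.Nullary.Decidable using (map′)
open import Relation.Unary using (Decidable)

private variable
  A : Set
  d m n : ℕ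
  B xs : List A

allLists : List A → ℕ → List (List A)
allLists B zero    = [ [] ]
allLists B (suc k) = cartesianProductWith _∷_ B (allLists B k)

∈-allLists⁺ : All (_∈ B) xs → xs ∈ allLists B (length xs)
∈-allLists⁺ []          = here refl
∈-allLists⁺ (x∈B ∷ xs⊆B) = ∈-cartesianProductWith⁺ _∷_ x∈B (∈-allLists⁺ xs⊆B)

∈-allLists⇒length : ∀ k → xs ∈ allLists B k → length xs ≡ k
∈-allLists⇒length zero (here refl) = refl
∈-allLists⇒length {B = B} (suc k) p with ∈-cartesianProductWith⁻ _∷_ B (allLists B k) p
... | _ , _ , _ , q , refl = cong suc (∈-allLists⇒length k q)

pigeonhole-∈ : (E : List A) (f : ℕ → A) → (∀ i → f i ∈ E) → ∃₂ λ i j → i < j × f i ≡ f j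
pigeonhole-∈ {A} E f f∈E with pigeonhole ≤-refl (λ (i : Fin _) → index (f∈E (toℕ i)))
... | i , j , i<j , same-index =
  toℕ i , toℕ j , i<j , index-injective (setoid A) (f∈E (toℕ i)) (f∈E (toℕ j)) same-index

map-≡⇒≡-on : ∀ {B : Set} {f g : A → B} {x} xs → map f xs ≡ map g xs → x ∈ xs → f x ≡ g x
map-≡⇒≡-on (_ ∷ _)  eq (here refl) = ∷-injectiveˡ eq
map-≡⇒≡-on (_ ∷ xs) eq (there x∈xs) = map-≡⇒≡-on xs (∷-injectiveʳ eq) x∈xs

++-injectiveˡ : ∀ (xs ys : List A) {us vs} → length xs ≡ length ys → xs ++ us ≡ ys ++ vs → xs ≡ ys
++-injectiveˡ []       []       _ _  = refl
++-injectiveˡ (x ∷ xs) (y ∷ ys) l eq =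
  cong₂ _∷_ (∷-injectiveˡ eq) (++-injectiveˡ xs ys (suc-injective l) (∷-injectiveʳ eq))

splitAt-length : ∀ k (xs : List A) → length xs ≡ k + m →
  ∃₂ λ us vs → us ++ vs ≡ xs × length us ≡ k × length vs ≡ m
splitAt-length {m = m} k xs l =
  take k xs , drop k xs , take++drop≡id k xs ,
  trans (length-take k xs) (trans (cong (k ⊓_) l) (m≤n⇒m⊓n≡m (m≤m+n k m))) ,
  trans (length-drop k xs) (trans (cong (_∸ k) l) (m+n∸m≡n k m))

lastHolding : {P : ℕ → Set} → Decidable P → ∀ k → P n → ¬ P (k + n) →
  ∃ λ j → P (j + n) × ¬ P (suc (j + n))
lastHolding P? zero    p ¬p = contradiction p ¬p
lastHolding {n} {P} P? (suc k) p ¬p with P? (suc n)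
... | no ¬p′ = 0 , p , ¬p′
... | yes p′ with lastHolding P? k p′ (¬p ∘ subst P (+-suc k n))
... | j , q , ¬q = suc j , subst P (+-suc j n) q , ¬q ∘ subst P (cong suc (sym (+-suc j n)))

level : ℕ → List (Word d)
level {d} = allLists (allFin d)

length⇒∈-level : (w : Word d) → length w ≡ n → w ∈ level n
length⇒∈-level w refl = ∈-allLists⁺ (All.tabulate (λ {x} _ → ∈-allFin x))

∈-level⇒length : {w : Word d} → w ∈ level n → length w ≡ n
∈-level⇒length = ∈-allLists⇒length _

Moves : Aut d → ℕ → Set
Moves g n = ∃ λ w → length w ≡ n × fun g w ≢ w

module _ (g : Aut d) where

  fixes? : Decidable (λ w → fun g w ≡ w)
  fixes? w = ≡-dec Fin._≟_ (fun g w) w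

  All-fixed⇒trivialOnLevel : All (λ w → fun g w ≡ w) (level n) → TrivialOnLevel g n
  All-fixed⇒trivialOnLevel fixed w |w| = All.lookup fixed (length⇒∈-level w |w|)

  trivialOnLevel⇒All-fixed : TrivialOnLevel g n → All (λ w → fun g w ≡ w) (level n)
  trivialOnLevel⇒All-fixed triv = All.tabulate (λ w∈ → triv _ (∈-level⇒length w∈))

  trivialOnLevel? : ∀ n → Dec (TrivialOnLevel g n)
  trivialOnLevel? n = map′ All-fixed⇒trivialOnLevel trivialOnLevel⇒All-fixed (all? fixes? (level n))

  ¬trivialOnLevel⇒moves : ¬ TrivialOnLevel g n → Moves g n
  ¬trivialOnLevel⇒moves {n} ¬triv
    with find (¬All⇒Any¬ fixes? (level n) (¬triv ∘ All-fixed⇒trivialOnLevel))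
  ... | w , w∈ , moved = w , ∈-level⇒length w∈ , moved

  trivialOnLevel-pred : TrivialOnLevel g (suc n) → TrivialOnLevel g n
  trivialOnLevel-pred triv []      refl with fun g [] | len g []
  ... | [] | _ = refl
  trivialOnLevel-pred triv (x ∷ w) refl with prefix g (x ∷ w) [ x ]
  ... | s , g[w++x] = ++-injectiveˡ (fun g (x ∷ w)) (x ∷ w) (len g (x ∷ w))
    (trans (sym g[w++x]) (triv (x ∷ w ++ [ x ]) (trans (length-++ (x ∷ w)) (+-comm _ 1))))

  trivialOnLevel-≤ : m ≤ n → TrivialOnLevel g n → TrivialOnLevel g m
  trivialOnLevel-≤ = go ∘ ≤⇒≤′
    where
    go : m ≤′ n → TrivialOnLevel g n → TrivialOnLevel g m
    go ≤′-refl       = λ triv → triv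
    go (≤′-step m≤n) = go m≤n ∘ trivialOnLevel-pred

actionOnLevel : Aut d → ℕ → List (Word d)
actionOnLevel g n = map (fun g) (level n)

actionOnLevel-∈ : (g : Aut d) (n : ℕ) → actionOnLevel g n ∈ allLists (level n) (length (level n))
actionOnLevel-∈ g n =
  subst (λ k → actionOnLevel g n ∈ allLists (level n) k) (length-map (fun g) (level n))
    (∈-allLists⁺ (map⁺ (All.tabulate image∈level)))
  where
  image∈level : ∀ {w} → w ∈ level n → fun g w ∈ level n
  image∈level w∈ = length⇒∈-level {n = n} (fun g _) (trans (len g _) (∈-level⇒length w∈))

module _ {G : Aut d → Set} where

  restriction-hasV : SelfSimilar G → ∀ {h} → G h → ∀ k n →
    TrivialOnLevel h (k + n) → Moves h (suc (k + n)) → ∃ λ g → G g × HasV g (fin n)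
  restriction-hasV ss {h} Gh k n triv (w , |w| , moved)
    with splitAt-length k w (trans |w| (sym (+-suc k n)))
  ... | u , y , refl , |u| , |y| with ss h Gh u
  ... | r , Gr , h-on-u = r , Gr , r-trivial , r-moves
    where
    open ≡-Reasoning

    u-fixed : fun h u ≡ u
    u-fixed = trivialOnLevel-≤ h (m≤m+n k n) triv u |u|

    r-trivial : TrivialOnLevel r n
    r-trivial v |v| = ++-cancelˡ u (fun r v) v (begin
      u ++ fun r v       ≡⟨ cong (_++ fun r v) u-fixed ⟨
      fun h u ++ fun r v ≡⟨ h-on-u v ⟨
      fun h (u ++ v)     ≡⟨ triv (u ++ v) (trans (length-++ u) (cong₂ _+_ |u| |v|)) ⟩
      u ++ v             ∎)

    r-moves : ¬ TrivialOnLevel r (suc n)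
    r-moves r-triv = moved (begin
      fun h (u ++ y)     ≡⟨ h-on-u y ⟩
      fun h u ++ fun r y ≡⟨ cong₂ _++_ u-fixed (r-triv y |y|) ⟩
      u ++ y             ∎)

  quotient-trivialOnLevel : IsSubgroup G → ∀ {g g′ w₀} → G g → G g′ →
    (∀ w → length w ≡ n → fun g w ≡ fun g′ w) → fun g w₀ ≢ fun g′ w₀ →
    ∃ λ h → G h × TrivialOnLevel h n × fun h w₀ ≢ w₀
  quotient-trivialOnLevel sg {g} {g′} {w₀} Gg Gg′ agree differ
    with IsSubgroup.has-inv sg g Gg
  ... | g⁻¹ , Gg⁻¹ , g⁻¹-acts with IsSubgroup.has-mul sg g⁻¹ g′ Gg⁻¹ Gg′
  ... | h , Gh , h-acts = h , Gh , h-trivial , h-moves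
    where
    open ≡-Reasoning

    h-acts-as-g⁻¹g′ : ∀ w → fun h w ≡ inv g (fun g′ w)
    h-acts-as-g⁻¹g′ w = trans (h-acts w) (g⁻¹-acts (fun g′ w))

    h-trivial : TrivialOnLevel h _
    h-trivial w |w| = begin
      fun h w          ≡⟨ h-acts-as-g⁻¹g′ w ⟩
      inv g (fun g′ w) ≡⟨ cong (inv g) (agree w |w|) ⟨
      inv g (fun g w)  ≡⟨ inv-l g w ⟩
      w                ∎

    h-moves : fun h w₀ ≢ w₀
    h-moves fixed = differ (begin
      fun g w₀                  ≡⟨ cong (fun g) fixed ⟨
      fun g (fun h w₀)          ≡⟨ cong (fun g) (h-acts-as-g⁻¹g′ w₀) ⟩
      fun g (inv g (fun g′ w₀)) ≡⟨ inv-r g (fun g′ w₀) ⟩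
      fun g′ w₀                 ∎)

  infinite⇒nontrivial-trivialOnLevel : IsSubgroup G → Infinite G → ∀ n →
    ∃ λ h → G h × TrivialOnLevel h n × ∃ λ w → fun h w ≢ w
  infinite⇒nontrivial-trivialOnLevel sg (f , Gf , distinct) n
    with pigeonhole-∈ _ (λ i → actionOnLevel (f i) n) (λ i → actionOnLevel-∈ (f i) n)
  ... | i , j , i<j , same-action with distinct i j (<⇒≢ i<j)
  ... | w₀ , differ with quotient-trivialOnLevel sg (Gf i) (Gf j) agree differ
    where
    agree : ∀ w → length w ≡ n → fun (f i) w ≡ fun (f j) w
    agree w |w| = map-≡⇒≡-on (level n) same-action (length⇒∈-level w |w|)
  ... | h , Gh , triv , moved = h , Gh , triv , w₀ , moved

proposition5p12 : (d : ℕ) → 2 ≤ d → (G : Aut d → Set) →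
    IsSubgroup G → SelfSimilar G → Infinite G →
    ∀ (k : ℕ∞) → ∃ λ g → G g × HasV g k
proposition5p12 _ _ G sg ss inf ∞ = IsSubgroup.has-id sg
proposition5p12 _ _ G sg ss inf (fin n)
  with infinite⇒nontrivial-trivialOnLevel sg inf n
... | h , Gh , triv , w₀ , moved
  with lastHolding (trivialOnLevel? h) (length w₀) triv
         (λ triv′ → moved (trivialOnLevel-≤ h (m≤m+n (length w₀) n) triv′ w₀ refl))
... | k , trivₖ , ¬triv = restriction-hasV ss Gh k n trivₖ (¬trivialOnLevel⇒moves h ¬triv)
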